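{- For every formula $\alpha$ of the language $\{\vee,\wedge,\neg,\square\}$: if $\models_{\cal TML}\alpha$, then $\vdash_{\mathbb T'}\alpha$.
   Context: $\mathfrak M_{4m}$ is the lattice $M_4=\{\mathbf 0,\mathbf n,\mathbf b,\mathbf 1\}$ ($\mathbf 0<\mathbf n,\mathbf b<\mathbf 1$, $\mathbf n,\mathbf b$ incomparable) with $\neg\mathbf 0=\mathbf 1$, $\neg\mathbf 1=\mathbf 0$, $\neg\mathbf n=\mathbf n$, $\neg\mathbf b=\mathbf b$, $\square\mathbf 1=\mathbf 1$, $\square x=\mathbf 0$ for $x\ne\mathbf 1$; it generates the variety of tetravalent modal algebras. Formulas are built from propositional variables with $\vee,\wedge,\neg,\square$; a valuation is a homomorphism $h$ into $\mathfrak M_{4m}$; $\models_{\cal TML}\alpha$ means $h(\alpha)=\mathbf 1$ for every valuation $h$. Signed formulas: $T(\alpha)$, $F(\alpha)$. Rules of $\mathbb T'$ (premise $\Rightarrow$ conclusion sets separated by $|$): $T(\alpha\vee\beta)\Rightarrow\{T(\alpha)\}|\{T(\beta)\}$; $T(\neg(\alpha\vee\beta))\Rightarrow\{T(\neg\alpha),T(\neg\beta)\}$; $F(\alpha\vee\beta)\Rightarrow\{F(\alpha),F(\beta)\}$; $F(\neg(\alpha\vee\beta))\Rightarrow\{F(\neg\alpha)\}|\{F(\neg\beta)\}$; $T(\alpha\wedge\beta)\Rightarrow\{T(\alpha),T(\beta)\}$; $T(\neg(\alpha\wedge\beta))\Rightarrow\{T(\neg\alpha)\}|\{T(\neg\beta)\}$;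 $F(\alpha\wedge\beta)\Rightarrow\{F(\alpha)\}|\{F(\beta)\}$; $F(\neg(\alpha\wedge\beta))\Rightarrow\{F(\neg\alpha),F(\neg\beta)\}$; $T(\neg\neg\alpha)\Rightarrow\{T(\alpha)\}$; $F(\neg\neg\alpha)\Rightarrow\{F(\alpha)\}$; $T(\square\alpha)\Rightarrow\{T(\alpha),F(\neg\alpha)\}$; $F(\square\alpha)\Rightarrow\{F(\alpha)\}|\{T(\neg\alpha)\}$; $T(\neg\square\alpha)\Rightarrow\{F(\square\alpha)\}$; $F(\neg\square\alpha)\Rightarrow\{T(\square\alpha)\}$. A tableau for $\eta$ is a finite tree with root $\eta$ built by repeatedly choosing a non-closed branch and a signed formula on it that is a rule premise, and extending the branch by one sub-branch per conclusion set. A branch is closed if it contains $T(\gamma)$ and $F(\gamma)$ for some $\gamma$; a tableau is closed if all branches are closed. $\vdash_{\mathbb T'}\alpha$ means there is a closed tableau of $\mathbb T'$ for $F(\alpha)$. -}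

module Defs where

open import Data.Nat using (ℕ)
open import Data.List using (List; []; _∷_; _++_; map)
open import Data.List.Membership.Propositional using (_∈_)
open import Data.List.Relation.Unary.All using (All)
open import Data.Product using (Σ; _×_; ∃-syntax)
open import Relation.Nullary using (¬_)
open import Relation.Binary.PropositionalEquality using (_≡_)

data Form : Set where
  var  : ℕ → Form
  _∨f_ : Form → Form → Form
  _∧f_ : Form → Form → Form
  ¬f_  : Form → Form
  □f_  : Form → Form

data M4 : Set where
  𝟎 𝐧 𝐛 𝟏 : M4

-- lattice join (0 < n, b < 1; n, b incomparable)
_⊔_ : M4 → M4 → M4
𝟎 ⊔ y = y
𝟏 ⊔ y = 𝟏
𝐧 ⊔ 𝟎 = 𝐧
𝐧 ⊔ 𝐧 = 𝐧
𝐧 ⊔ 𝐛 = 𝟏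
𝐧 ⊔ 𝟏 = 𝟏
𝐛 ⊔ 𝟎 = 𝐛
𝐛 ⊔ 𝐧 = 𝟏
𝐛 ⊔ 𝐛 = 𝐛
𝐛 ⊔ 𝟏 = 𝟏

_⊓_ : M4 → M4 → M4
𝟎 ⊓ y = 𝟎
𝟏 ⊓ y = y
𝐧 ⊓ 𝟎 = 𝟎
𝐧 ⊓ 𝐧 = 𝐧
𝐧 ⊓ 𝐛 = 𝟎
𝐧 ⊓ 𝟏 = 𝐧
𝐛 ⊓ 𝟎 = 𝟎
𝐛 ⊓ 𝐧 = 𝟎
𝐛 ⊓ 𝐛 = 𝐛
𝐛 ⊓ 𝟏 = 𝐛

∼_ : M4 → M4
∼ 𝟎 = 𝟏
∼ 𝐧 = 𝐧
∼ 𝐛 = 𝐛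
∼ 𝟏 = 𝟎

□_ : M4 → M4
□ 𝟏 = 𝟏
□ 𝟎 = 𝟎
□ 𝐧 = 𝟎
□ 𝐛 = 𝟎

-- A valuation (homomorphism Form → 𝔐₄ₘ) is determined by its values on
-- the variables; `eval v` is the unique homomorphic extension of v.
eval : (ℕ → M4) → Form → M4
eval v (var x)   = v x
eval v (α ∨f β)  = eval v α ⊔ eval v β
eval v (α ∧f β)  = eval v α ⊓ eval v β
eval v (¬f α)    = ∼ eval v α
eval v (□f α)    = □ eval v α

⊨TML : Form → Set
⊨TML α = (v : ℕ → M4) → eval v α ≡ 𝟏

data SForm : Set where
  T F : Form → SForm

-- Rule φ cs : φ is the premise of a rule of 𝕋′ whose conclusion sets
-- (one per sub-branch) are the list cs.
data Rule : SForm → List (List SForm) → Set where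
  T∨  : ∀ α β → Rule (T (α ∨f β)) ((T α ∷ []) ∷ (T β ∷ []) ∷ [])
  T¬∨ : ∀ α β → Rule (T (¬f (α ∨f β))) ((T (¬f α) ∷ T (¬f β) ∷ []) ∷ [])
  F∨  : ∀ α β → Rule (F (α ∨f β)) ((F α ∷ F β ∷ []) ∷ [])
  F¬∨ : ∀ α β → Rule (F (¬f (α ∨f β))) ((F (¬f α) ∷ []) ∷ (F (¬f β) ∷ []) ∷ [])
  T∧  : ∀ α β → Rule (T (α ∧f β)) ((T α ∷ T β ∷ []) ∷ [])
  T¬∧ : ∀ α β → Rule (T (¬f (α ∧f β))) ((T (¬f α) ∷ []) ∷ (T (¬f β) ∷ []) ∷ [])
  F∧  : ∀ α β → Rule (F (α ∧f β)) ((F α ∷ []) ∷ (F β ∷ []) ∷ [])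
  F¬∧ : ∀ α β → Rule (F (¬f (α ∧f β))) ((F (¬f α) ∷ F (¬f β) ∷ []) ∷ [])
  T¬¬ : ∀ α → Rule (T (¬f (¬f α))) ((T α ∷ []) ∷ [])
  F¬¬ : ∀ α → Rule (F (¬f (¬f α))) ((F α ∷ []) ∷ [])
  T□  : ∀ α → Rule (T (□f α)) ((T α ∷ F (¬f α) ∷ []) ∷ [])
  F□  : ∀ α → Rule (F (□f α)) ((F α ∷ []) ∷ (T (¬f α) ∷ []) ∷ [])
  T¬□ : ∀ α → Rule (T (¬f (□f α))) ((F (□f α) ∷ []) ∷ [])
  F¬□ : ∀ α → Rule (F (¬f (□f α))) ((T (□f α) ∷ []) ∷ [])

-- Tableaux.  A branch is the list of signed formulas on a root-to-leaf
-- path; a (finite) tableau is represented by the list of its branches.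

Branch : Set
Branch = List SForm

Closed : Branch → Set
Closed B = Σ Form λ γ → (T γ ∈ B) × (F γ ∈ B)

data Step : List Branch → List Branch → Set where
  expand : ∀ (Bs₁ Bs₂ : List Branch) (B : Branch) (φ : SForm)
             (cs : List (List SForm)) →
           ¬ Closed B → φ ∈ B → Rule φ cs →
           Step (Bs₁ ++ B ∷ Bs₂) (Bs₁ ++ map (B ++_) cs ++ Bs₂)

data Steps : List Branch → List Branch → Set where
  done : ∀ {Bs} → Steps Bs Bs
  step : ∀ {Bs Cs Ds} → Step Bs Cs → Steps Cs Ds → Steps Bs Ds

ClosedTableau : SForm → Set
ClosedTableau η = Σ (List Branch) λ Bs → Steps ((η ∷ []) ∷ []) Bs × All Closed Bs

⊢T′ : Form → Set
⊢T′ α = ClosedTableau (F α)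

-- Read T γ as "h(γ) is designated" and F γ as "h(γ) is not designated", for
-- the designated set D = {𝐧, 𝟏}.  The map a ↦ (a ∈ D , ∼ a ∈ D) identifies
-- M₄ with Bool × Bool, and through it ⊔, ⊓, ∼ and □ become Boolean operations
-- on the two components.  Consequently every rule of 𝕋′ is invertible: a
-- valuation satisfying one of its conclusion sets satisfies its premise.
-- Systematic expansion of a tableau for F α terminates, because every rule
-- lowers a weight, so either all branches close or some open branch is
-- saturated.  The literals T p, F p, T ¬p, F ¬p on a saturated open branch
-- prescribe both components of each h(p); by invertibility this valuation
-- satisfies every formula of the branch, in particular F α, so h(α) ≠ 𝟏.
module Submission where

open import Defs
open import Data.Nat using (ℕ; zero; suc; _+_; _<_; s≤s; s≤s⁻¹)
  renaming (_≟_ to _≟ℕ_)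
open import Data.Nat.Properties using (≤-refl; ≤-<-trans; m≤n+m; m≤m+n; +-monoˡ-<; +-identityʳ; module ≤-Reasoning)
open import Data.Bool using (Bool; true; false; _∨_; _∧_; not)
open import Data.Bool.Properties using (∨-zeroʳ; ∧-zeroʳ)
open import Data.List using (List; []; _∷_; _++_; map)
open import Data.Nat.ListAction using (sum)
open import Data.Nat.ListAction.Properties using (sum-++)
open import Data.List.Properties using (++-assoc; ++-identityʳ; map-++)
open import Data.List.Membership.Propositional using (_∈_)
open import Data.List.Membership.Propositional.Properties using (∈-++⁺ˡ; ∈-++⁺ʳ)
import Data.List.Membership.DecPropositional as DecMembership
open import Data.List.Relation.Unary.All as All using (All; []; _∷_)
open import Data.List.Relation.Unary.All.Properties using (++⁺; ++⁻ˡ; ++⁻ʳ)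
open import Data.List.Relation.Unary.Any using (here; there)
open import Data.Product using (Σ; _×_; _,_; ∃; ∃-syntax; uncurry)
open import Data.Sum using (_⊎_; inj₁; inj₂)
open import Data.Empty using (⊥-elim)
open import Relation.Nullary using (¬_; Dec; yes; no; does)
open import Relation.Nullary.Decidable using (map′; _×-dec_; dec-true; dec-false)
open import Relation.Binary.Definitions using (DecidableEquality)
open import Relation.Binary.PropositionalEquality using (_≡_; refl; sym; trans; cong; cong₂; subst; subst₂)

designated : M4 → Bool
designated 𝟎 = false
designated 𝐧 = true
designated 𝐛 = false
designated 𝟏 = true

designated-⊔ : ∀ a b → designated (a ⊔ b) ≡ designated a ∨ designated b
designated-⊔ 𝟎 b = refl
designated-⊔ 𝟏 b = refl
designated-⊔ 𝐧 𝟎 = refl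
designated-⊔ 𝐧 𝐧 = refl
designated-⊔ 𝐧 𝐛 = refl
designated-⊔ 𝐧 𝟏 = refl
designated-⊔ 𝐛 𝟎 = refl
designated-⊔ 𝐛 𝐧 = refl
designated-⊔ 𝐛 𝐛 = refl
designated-⊔ 𝐛 𝟏 = refl

designated∼-⊔ : ∀ a b → designated (∼ (a ⊔ b)) ≡ designated (∼ a) ∧ designated (∼ b)
designated∼-⊔ 𝟎 b = refl
designated∼-⊔ 𝟏 b = refl
designated∼-⊔ 𝐧 𝟎 = refl
designated∼-⊔ 𝐧 𝐧 = refl
designated∼-⊔ 𝐧 𝐛 = refl
designated∼-⊔ 𝐧 𝟏 = refl
designated∼-⊔ 𝐛 𝟎 = refl
designated∼-⊔ 𝐛 𝐧 = refl
designated∼-⊔ 𝐛 𝐛 = refl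
designated∼-⊔ 𝐛 𝟏 = refl

designated-⊓ : ∀ a b → designated (a ⊓ b) ≡ designated a ∧ designated b
designated-⊓ 𝟎 b = refl
designated-⊓ 𝟏 b = refl
designated-⊓ 𝐧 𝟎 = refl
designated-⊓ 𝐧 𝐧 = refl
designated-⊓ 𝐧 𝐛 = refl
designated-⊓ 𝐧 𝟏 = refl
designated-⊓ 𝐛 𝟎 = refl
designated-⊓ 𝐛 𝐧 = refl
designated-⊓ 𝐛 𝐛 = refl
designated-⊓ 𝐛 𝟏 = refl

designated∼-⊓ : ∀ a b → designated (∼ (a ⊓ b)) ≡ designated (∼ a) ∨ designated (∼ b)
designated∼-⊓ 𝟎 b = refl
designated∼-⊓ 𝟏 b = refl
designated∼-⊓ 𝐧 𝟎 = refl
designated∼-⊓ 𝐧 𝐧 = refl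
designated∼-⊓ 𝐧 𝐛 = refl
designated∼-⊓ 𝐧 𝟏 = refl
designated∼-⊓ 𝐛 𝟎 = refl
designated∼-⊓ 𝐛 𝐧 = refl
designated∼-⊓ 𝐛 𝐛 = refl
designated∼-⊓ 𝐛 𝟏 = refl

designated-∼∼ : ∀ a → designated (∼ (∼ a)) ≡ designated a
designated-∼∼ 𝟎 = refl
designated-∼∼ 𝐧 = refl
designated-∼∼ 𝐛 = refl
designated-∼∼ 𝟏 = refl

designated-□ : ∀ a → designated (□ a) ≡ designated a ∧ not (designated (∼ a))
designated-□ 𝟎 = refl
designated-□ 𝐧 = refl
designated-□ 𝐛 = refl
designated-□ 𝟏 = refl

designated∼-□ : ∀ a → designated (∼ (□ a)) ≡ not (designated (□ a))
designated∼-□ 𝟎 = refl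
designated∼-□ 𝐧 = refl
designated∼-□ 𝐛 = refl
designated∼-□ 𝟏 = refl

encode : Bool → Bool → M4
encode true  true  = 𝐧
encode true  false = 𝟏
encode false true  = 𝟎
encode false false = 𝐛

designated-encode : ∀ t s → designated (encode t s) ≡ t
designated-encode true  true  = refl
designated-encode true  false = refl
designated-encode false true  = refl
designated-encode false false = refl

designated∼-encode : ∀ t s → designated (∼ encode t s) ≡ s
designated∼-encode true  true  = refl
designated∼-encode true  false = refl
designated∼-encode false true  = refl
designated∼-encode false false = refl

_⊨_ : (ℕ → M4) → SForm → Set
v ⊨ T γ = designated (eval v γ) ≡ true
v ⊨ F γ = designated (eval v γ) ≡ false

⊨-premise : ∀ {v φ cs C} → Rule φ cs → C ∈ cs → All (v ⊨_) C → v ⊨ φ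
⊨-premise {v} (T∨ α β) (here refl) (p ∷ []) =
  trans (designated-⊔ (eval v α) (eval v β)) (cong (_∨ _) p)
⊨-premise {v} (T∨ α β) (there (here refl)) (p ∷ []) =
  trans (designated-⊔ (eval v α) (eval v β)) (trans (cong (_ ∨_) p) (∨-zeroʳ _))
⊨-premise {v} (T¬∨ α β) (here refl) (p ∷ q ∷ []) =
  trans (designated∼-⊔ (eval v α) (eval v β)) (cong₂ _∧_ p q)
⊨-premise {v} (F∨ α β) (here refl) (p ∷ q ∷ []) =
  trans (designated-⊔ (eval v α) (eval v β)) (cong₂ _∨_ p q)
⊨-premise {v} (F¬∨ α β) (here refl) (p ∷ []) =
  trans (designated∼-⊔ (eval v α) (eval v β)) (cong (_∧ _) p)
⊨-premise {v} (F¬∨ α β) (there (here refl)) (p ∷ []) =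
  trans (designated∼-⊔ (eval v α) (eval v β)) (trans (cong (_ ∧_) p) (∧-zeroʳ _))
⊨-premise {v} (T∧ α β) (here refl) (p ∷ q ∷ []) =
  trans (designated-⊓ (eval v α) (eval v β)) (cong₂ _∧_ p q)
⊨-premise {v} (T¬∧ α β) (here refl) (p ∷ []) =
  trans (designated∼-⊓ (eval v α) (eval v β)) (cong (_∨ _) p)
⊨-premise {v} (T¬∧ α β) (there (here refl)) (p ∷ []) =
  trans (designated∼-⊓ (eval v α) (eval v β)) (trans (cong (_ ∨_) p) (∨-zeroʳ _))
⊨-premise {v} (F∧ α β) (here refl) (p ∷ []) =
  trans (designated-⊓ (eval v α) (eval v β)) (cong (_∧ _) p)
⊨-premise {v} (F∧ α β) (there (here refl)) (p ∷ []) =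
  trans (designated-⊓ (eval v α) (eval v β)) (trans (cong (_ ∧_) p) (∧-zeroʳ _))
⊨-premise {v} (F¬∧ α β) (here refl) (p ∷ q ∷ []) =
  trans (designated∼-⊓ (eval v α) (eval v β)) (cong₂ _∨_ p q)
⊨-premise {v} (T¬¬ α) (here refl) (p ∷ []) = trans (designated-∼∼ (eval v α)) p
⊨-premise {v} (F¬¬ α) (here refl) (p ∷ []) = trans (designated-∼∼ (eval v α)) p
⊨-premise {v} (T□ α) (here refl) (p ∷ q ∷ []) =
  trans (designated-□ (eval v α)) (cong₂ (λ t s → t ∧ not s) p q)
⊨-premise {v} (F□ α) (here refl) (p ∷ []) =
  trans (designated-□ (eval v α)) (cong (_∧ not (designated (∼ eval v α))) p)
⊨-premise {v} (F□ α) (there (here refl)) (p ∷ []) =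
  trans (designated-□ a) (trans (cong (λ s → designated a ∧ not s) p) (∧-zeroʳ (designated a)))
  where a = eval v α
⊨-premise {v} (T¬□ α) (here refl) (p ∷ []) = trans (designated∼-□ (eval v α)) (cong not p)
⊨-premise {v} (F¬□ α) (here refl) (p ∷ []) = trans (designated∼-□ (eval v α)) (cong not p)

_≟_ : DecidableEquality Form
var x ≟ var y = map′ (cong var) (λ { refl → refl }) (x ≟ℕ y)
(α ∨f β) ≟ (γ ∨f δ) = map′ (uncurry (cong₂ _∨f_)) (λ { refl → refl , refl }) (α ≟ γ ×-dec β ≟ δ)
(α ∧f β) ≟ (γ ∧f δ) = map′ (uncurry (cong₂ _∧f_)) (λ { refl → refl , refl }) (α ≟ γ ×-dec β ≟ δ)
(¬f α) ≟ (¬f γ) = map′ (cong ¬f_) (λ { refl → refl }) (α ≟ γ)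
(□f α) ≟ (□f γ) = map′ (cong □f_) (λ { refl → refl }) (α ≟ γ)
var _ ≟ (_ ∨f _) = no λ ()
var _ ≟ (_ ∧f _) = no λ ()
var _ ≟ (¬f _) = no λ ()
var _ ≟ (□f _) = no λ ()
(_ ∨f _) ≟ var _ = no λ ()
(_ ∨f _) ≟ (_ ∧f _) = no λ ()
(_ ∨f _) ≟ (¬f _) = no λ ()
(_ ∨f _) ≟ (□f _) = no λ ()
(_ ∧f _) ≟ var _ = no λ ()
(_ ∧f _) ≟ (_ ∨f _) = no λ ()
(_ ∧f _) ≟ (¬f _) = no λ ()
(_ ∧f _) ≟ (□f _) = no λ ()
(¬f _) ≟ var _ = no λ ()
(¬f _) ≟ (_ ∨f _) = no λ ()
(¬f _) ≟ (_ ∧f _) = no λ ()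
(¬f _) ≟ (□f _) = no λ ()
(□f _) ≟ var _ = no λ ()
(□f _) ≟ (_ ∨f _) = no λ ()
(□f _) ≟ (_ ∧f _) = no λ ()
(□f _) ≟ (¬f _) = no λ ()

_≟ˢ_ : DecidableEquality SForm
T γ ≟ˢ T δ = map′ (cong T) (λ { refl → refl }) (γ ≟ δ)
F γ ≟ˢ F δ = map′ (cong F) (λ { refl → refl }) (γ ≟ δ)
T _ ≟ˢ F _ = no λ ()
F _ ≟ˢ T _ = no λ ()

open DecMembership _≟ˢ_ using (_∈?_)

closedBetween? : ∀ (L B : Branch) → Dec (Σ Form λ γ → T γ ∈ L × F γ ∈ B)
closedBetween? [] B = no λ ()
closedBetween? (T γ ∷ L) B with F γ ∈? B | closedBetween? L B
... | yes Fγ∈B | _ = yes (γ , here refl , Fγ∈B)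
... | no _ | yes (δ , Tδ∈L , Fδ∈B) = yes (δ , there Tδ∈L , Fδ∈B)
... | no Fγ∉B | no none = no λ
  { (_ , here refl , Fγ∈B) → Fγ∉B Fγ∈B
  ; (δ , there Tδ∈L , Fδ∈B) → none (δ , Tδ∈L , Fδ∈B) }
closedBetween? (F γ ∷ L) B with closedBetween? L B
... | yes (δ , Tδ∈L , Fδ∈B) = yes (δ , there Tδ∈L , Fδ∈B)
... | no none = no λ { (δ , there Tδ∈L , Fδ∈B) → none (δ , Tδ∈L , Fδ∈B) }

closed? : ∀ B → Dec (Closed B)
closed? B = closedBetween? B B

data Literal : SForm → Set where
  Tvar  : ∀ x → Literal (T (var x))
  Fvar  : ∀ x → Literal (F (var x))
  T¬var : ∀ x → Literal (T (¬f var x))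
  F¬var : ∀ x → Literal (F (¬f var x))

literal-or-premise : ∀ φ → Literal φ ⊎ ∃ (Rule φ)
literal-or-premise (T (var x))         = inj₁ (Tvar x)
literal-or-premise (T (¬f var x))      = inj₁ (T¬var x)
literal-or-premise (F (var x))         = inj₁ (Fvar x)
literal-or-premise (F (¬f var x))      = inj₁ (F¬var x)
literal-or-premise (T (α ∨f β))        = inj₂ (_ , T∨ α β)
literal-or-premise (T (α ∧f β))        = inj₂ (_ , T∧ α β)
literal-or-premise (T (□f α))          = inj₂ (_ , T□ α)
literal-or-premise (T (¬f (α ∨f β)))   = inj₂ (_ , T¬∨ α β)
literal-or-premise (T (¬f (α ∧f β)))   = inj₂ (_ , T¬∧ α β)
literal-or-premise (T (¬f (¬f α)))     = inj₂ (_ , T¬¬ α)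
literal-or-premise (T (¬f (□f α)))     = inj₂ (_ , T¬□ α)
literal-or-premise (F (α ∨f β))        = inj₂ (_ , F∨ α β)
literal-or-premise (F (α ∧f β))        = inj₂ (_ , F∧ α β)
literal-or-premise (F (□f α))          = inj₂ (_ , F□ α)
literal-or-premise (F (¬f (α ∨f β)))   = inj₂ (_ , F¬∨ α β)
literal-or-premise (F (¬f (α ∧f β)))   = inj₂ (_ , F¬∧ α β)
literal-or-premise (F (¬f (¬f α)))     = inj₂ (_ , F¬¬ α)
literal-or-premise (F (¬f (□f α)))     = inj₂ (_ , F¬□ α)

-- weight¬ α is the weight of ¬f α; the two are defined simultaneously so
-- that each conclusion set of a rule weighs less than its premise.
mutual
  weight : Form → ℕ
  weight (var x)  = 1
  weight (α ∨f β) = suc (weight α + weight β)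
  weight (α ∧f β) = suc (weight α + weight β)
  weight (¬f α)   = weight¬ α
  weight (□f α)   = suc (weight α + weight¬ α)

  weight¬ : Form → ℕ
  weight¬ (var x)  = 1
  weight¬ (α ∨f β) = suc (weight¬ α + weight¬ β)
  weight¬ (α ∧f β) = suc (weight¬ α + weight¬ β)
  weight¬ (¬f α)   = suc (weight α)
  weight¬ (□f α)   = suc (weight (□f α))

weightˢ : SForm → ℕ
weightˢ (T γ) = weight γ
weightˢ (F γ) = weight γ

Σweight : List SForm → ℕ
Σweight C = sum (map weightˢ C)

Σweight-++ : ∀ C D → Σweight (C ++ D) ≡ Σweight C + Σweight D
Σweight-++ C D = trans (cong sum (map-++ weightˢ C D)) (sum-++ (map weightˢ C) (map weightˢ D))

m+0<1+m : ∀ m → m + 0 < suc m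
m+0<1+m m rewrite +-identityʳ m = ≤-refl

m+0<1+m+n : ∀ m n → m + 0 < suc (m + n)
m+0<1+m+n m n rewrite +-identityʳ m = s≤s (m≤m+n m n)

n+0<1+m+n : ∀ m n → n + 0 < suc (m + n)
n+0<1+m+n m n rewrite +-identityʳ n = s≤s (m≤n+m n m)

m+[n+0]<1+m+n : ∀ m n → m + (n + 0) < suc (m + n)
m+[n+0]<1+m+n m n rewrite +-identityʳ n = ≤-refl

rule-decreases : ∀ {φ cs} → Rule φ cs → All (λ C → Σweight C < weightˢ φ) cs
rule-decreases (T∨ α β)  = m+0<1+m+n (weight α) (weight β) ∷ n+0<1+m+n (weight α) (weight β) ∷ []
rule-decreases (T¬∨ α β) = m+[n+0]<1+m+n (weight¬ α) (weight¬ β) ∷ []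
rule-decreases (F∨ α β)  = m+[n+0]<1+m+n (weight α) (weight β) ∷ []
rule-decreases (F¬∨ α β) = m+0<1+m+n (weight¬ α) (weight¬ β) ∷ n+0<1+m+n (weight¬ α) (weight¬ β) ∷ []
rule-decreases (T∧ α β)  = m+[n+0]<1+m+n (weight α) (weight β) ∷ []
rule-decreases (T¬∧ α β) = m+0<1+m+n (weight¬ α) (weight¬ β) ∷ n+0<1+m+n (weight¬ α) (weight¬ β) ∷ []
rule-decreases (F∧ α β)  = m+0<1+m+n (weight α) (weight β) ∷ n+0<1+m+n (weight α) (weight β) ∷ []
rule-decreases (F¬∧ α β) = m+[n+0]<1+m+n (weight¬ α) (weight¬ β) ∷ []
rule-decreases (T¬¬ α)   = m+0<1+m (weight α) ∷ []
rule-decreases (F¬¬ α)   = m+0<1+m (weight α) ∷ []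
rule-decreases (T□ α)    = m+[n+0]<1+m+n (weight α) (weight¬ α) ∷ []
rule-decreases (F□ α)    = m+0<1+m+n (weight α) (weight¬ α) ∷ n+0<1+m+n (weight α) (weight¬ α) ∷ []
rule-decreases (T¬□ α)   = m+0<1+m (weight (□f α)) ∷ []
rule-decreases (F¬□ α)   = m+0<1+m (weight (□f α)) ∷ []

data Closable : Branch → Set where
  closed : ∀ {B} → Closed B → Closable B
  expand : ∀ {B φ cs} → ¬ Closed B → φ ∈ B → Rule φ cs →
           All (λ C → Closable (B ++ C)) cs → Closable B

LiteralsHold : (ℕ → M4) → Branch → Set
LiteralsHold v B = ∀ {φ} → Literal φ → φ ∈ B → v ⊨ φ

branchValuation : Branch → ℕ → M4
branchValuation B x = encode (does (T (var x) ∈? B)) (does (T (¬f var x) ∈? B))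

literals-hold : ∀ {B} → ¬ Closed B → LiteralsHold (branchValuation B) B
literals-hold {B} ¬closed (Tvar x) φ∈B =
  trans (designated-encode _ _) (dec-true (T (var x) ∈? B) φ∈B)
literals-hold {B} ¬closed (Fvar x) φ∈B =
  trans (designated-encode _ _) (dec-false (T (var x) ∈? B) λ T∈B → ¬closed (var x , T∈B , φ∈B))
literals-hold {B} ¬closed (T¬var x) φ∈B =
  trans (designated∼-encode _ _) (dec-true (T (¬f var x) ∈? B) φ∈B)
literals-hold {B} ¬closed (F¬var x) φ∈B =
  trans (designated∼-encode _ _) (dec-false (T (¬f var x) ∈? B) λ T∈B → ¬closed (¬f var x , T∈B , φ∈B))

all-∈-extend : ∀ B C {rest : List SForm} → All (_∈ B) rest → All (_∈ B ++ C) (C ++ rest)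
all-∈-extend B C rest⊆B = ++⁺ (All.tabulate (∈-++⁺ʳ B)) (All.map ∈-++⁺ˡ rest⊆B)

conclusions-lighter : ∀ {φ cs} m rest → Rule φ cs → Σweight (φ ∷ rest) < suc m →
                      All (λ C → Σweight (C ++ rest) < m) cs
conclusions-lighter {φ} m rest r bound = All.map (λ {C} → lighter {C}) (rule-decreases r)
  where
  lighter : ∀ {C} → Σweight C < weightˢ φ → Σweight (C ++ rest) < m
  lighter {C} C<φ = begin-strict
    Σweight (C ++ rest)         ≡⟨ Σweight-++ C rest ⟩
    Σweight C + Σweight rest    <⟨ +-monoˡ-< (Σweight rest) C<φ ⟩
    weightˢ φ + Σweight rest    ≤⟨ s≤s⁻¹ bound ⟩
    m                           ∎
    where open ≤-Reasoning

Outcome : Branch → List SForm → Set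
Outcome B todo = Closable B ⊎ ∃[ v ] All (v ⊨_) todo × LiteralsHold v B

ChildOutcomes : Branch → List SForm → List (List SForm) → Set
ChildOutcomes B rest cs =
  All (λ C → Closable (B ++ C)) cs ⊎
  ∃[ C ] C ∈ cs × ∃[ v ] All (v ⊨_) (C ++ rest) × LiteralsHold v (B ++ C)

mutual
  search : ∀ n todo B → Σweight todo < n → All (_∈ B) todo → Outcome B todo
  search n [] B _ _ with closed? B
  ... | yes c  = inj₁ (closed c)
  ... | no ¬c = inj₂ (branchValuation B , [] , literals-hold ¬c)
  search n (φ ∷ rest) B bound (φ∈B ∷ rest⊆B) with literal-or-premise φ | closed? B
  ... | _ | yes c = inj₁ (closed c)
  ... | inj₂ (_ , r) | no ¬c = expandPremise n r ¬c bound φ∈B rest⊆B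
  ... | inj₁ lit | no _ with search n rest B (≤-<-trans (m≤n+m _ (weightˢ φ)) bound) rest⊆B
  ...   | inj₁ cl = inj₁ cl
  ...   | inj₂ (v , v⊨rest , lits) = inj₂ (v , lits lit φ∈B ∷ v⊨rest , lits)

  expandPremise : ∀ n {B φ cs rest} → Rule φ cs → ¬ Closed B → Σweight (φ ∷ rest) < n →
                  φ ∈ B → All (_∈ B) rest → Outcome B (φ ∷ rest)
  expandPremise zero _ _ () _ _
  expandPremise (suc m) {B} {rest = rest} r ¬c bound φ∈B rest⊆B
    with searchChildren m B rest _ (conclusions-lighter m rest r bound) rest⊆B
  ... | inj₁ children = inj₁ (expand ¬c φ∈B r children)
  ... | inj₂ (C , C∈cs , v , v⊨C++rest , lits) =
    inj₂ (v , ⊨-premise r C∈cs (++⁻ˡ C v⊨C++rest) ∷ ++⁻ʳ C v⊨C++rest , λ lit φ∈B → lits lit (∈-++⁺ˡ φ∈B))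

  searchChildren : ∀ m B rest cs → All (λ C → Σweight (C ++ rest) < m) cs → All (_∈ B) rest →
                   ChildOutcomes B rest cs
  searchChildren m B rest [] _ _ = inj₁ []
  searchChildren m B rest (C ∷ cs) (bound ∷ bounds) rest⊆B
    with search m (C ++ rest) (B ++ C) bound (all-∈-extend B C rest⊆B)
  ... | inj₂ model = inj₂ (C , here refl , model)
  ... | inj₁ cl with searchChildren m B rest cs bounds rest⊆B
  ...   | inj₁ cls = inj₁ (cl ∷ cls)
  ...   | inj₂ (C′ , C′∈cs , model) = inj₂ (C′ , there C′∈cs , model)

Steps-trans : ∀ {As Bs Cs} → Steps As Bs → Steps Bs Cs → Steps As Cs
Steps-trans done            later = later
Steps-trans (step s earlier) later = step s (Steps-trans earlier later)

mutual
  closable⇒steps : ∀ {B} → Closable B → ∀ Bs₁ Bs₂ →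
                   ∃[ Ds ] Steps (Bs₁ ++ B ∷ Bs₂) (Bs₁ ++ Ds ++ Bs₂) × All Closed Ds
  closable⇒steps {B} (closed c) Bs₁ Bs₂ = B ∷ [] , done , c ∷ []
  closable⇒steps {B} (expand {φ = φ} {cs} ¬c φ∈B r children) Bs₁ Bs₂
    with closable-children⇒steps children Bs₁ Bs₂
  ... | Ds , steps , Ds-closed = Ds , step (expand Bs₁ Bs₂ B φ cs ¬c φ∈B r) steps , Ds-closed

  closable-children⇒steps : ∀ {B cs} → All (λ C → Closable (B ++ C)) cs → ∀ Bs₁ Bs₂ →
                            ∃[ Ds ] Steps (Bs₁ ++ map (B ++_) cs ++ Bs₂) (Bs₁ ++ Ds ++ Bs₂) × All Closed Ds
  closable-children⇒steps [] Bs₁ Bs₂ = [] , done , []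
  closable-children⇒steps {B} {C ∷ cs} (cl ∷ cls) Bs₁ Bs₂
    with closable⇒steps cl Bs₁ (map (B ++_) cs ++ Bs₂)
  ... | D₁ , steps₁ , D₁-closed with closable-children⇒steps cls (Bs₁ ++ D₁) Bs₂
  ...   | D₂ , steps₂ , D₂-closed =
    D₁ ++ D₂ , Steps-trans steps₁ (subst₂ Steps regroup-source regroup-target steps₂) , ++⁺ D₁-closed D₂-closed
    where
    regroup-source : (Bs₁ ++ D₁) ++ map (B ++_) cs ++ Bs₂ ≡ Bs₁ ++ D₁ ++ map (B ++_) cs ++ Bs₂
    regroup-source = ++-assoc Bs₁ D₁ _
    regroup-target : (Bs₁ ++ D₁) ++ D₂ ++ Bs₂ ≡ Bs₁ ++ (D₁ ++ D₂) ++ Bs₂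
    regroup-target = trans (++-assoc Bs₁ D₁ _) (cong (Bs₁ ++_) (sym (++-assoc D₁ D₂ Bs₂)))

closable⇒closedTableau : ∀ {η} → Closable (η ∷ []) → ClosedTableau η
closable⇒closedTableau cl with closable⇒steps cl [] []
... | Ds , steps , Ds-closed = Ds , subst (Steps _) (++-identityʳ Ds) steps , Ds-closed

closedTableau-or-countermodel : ∀ η → ClosedTableau η ⊎ ∃[ v ] v ⊨ η
closedTableau-or-countermodel η with search _ (η ∷ []) (η ∷ []) ≤-refl (here refl ∷ [])
... | inj₁ cl = inj₁ (closable⇒closedTableau cl)
... | inj₂ (v , v⊨η ∷ [] , _) = inj₂ (v , v⊨η)

valid-refutes-F : ∀ α → ⊨TML α → ∀ v → ¬ (v ⊨ F α)
valid-refutes-F α ⊨α v rewrite ⊨α v = λ ()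

theorem6p6 : (α : Form) → ⊨TML α → ⊢T′ α
theorem6p6 α ⊨α with closedTableau-or-countermodel (F α)
... | inj₁ tableau      = tableau
... | inj₂ (v , v⊨Fα) = ⊥-elim (valid-refutes-F α ⊨α v v⊨Fα)
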